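{- Let $\mathcal{G}=(G,\lambda)$ be a simple temporal clique with $G=(V,E)$, with emitters and collectors defined as below, and suppose that every vertex of $V$ is an emitter or a collector. (1) If there is an emitter $u$ with $e^-(u)=\{u,v\}$ such that $\{u,v\}$ is not the edge of smallest label among the edges $\{v,x\}$ with $x$ an emitter, then $\mathcal{G}$ contains a $2$-hop dismountable vertex. (2) If there is a collector $v$ with $e^+(v)=\{v,u\}$ such that $\{v,u\}$ is not the edge of largest label among the edges $\{u,y\}$ with $y$ a collector, then $\mathcal{G}$ contains a $2$-hop dismountable vertex.
   Context: A simple temporal clique is a pair $\mathcal{G}=(G,\lambda)$ where $G=(V,E)$ is the complete graph on a finite vertex set $V$ with $|V|\ge 2$, and $\lambda:E\to\mathbb{N}$ assigns each edge a single label such that any two distinct edges sharing an endpoint have distinct labels. A journey is a sequence of edges $\{u_1,u_2\},\dots,\{u_k,u_{k+1}\}$ ($k\ge1$) with the $u_i$ pairwise distinct and strictly increasing labels; $k$ is its number of hops. For a vertex $v$, $e^-(v)$ (resp. $e^+(v)$) denotes the edge incident to $v$ with the smallest (resp. largest) label. A vertex $x$ is $2$-hop dismountable if there exist vertices $y,z$ different from $x$ (possibly $y=z$) such that there is a journey of at most $2$ hops from $x$ to $y$ whose last edge is $e^-(y)$, and a journey of at most $2$ hops from $z$ to $x$ whose first edge is $e^+(z)$. Forward structure: $E^-$ is the set of arcs containing, for each vertex $v$ with $e^-(v)=\{u,v\}$, the arc $(u,v)$, except that whenever $e^-(u)=e^-(v)$ only one of $(u,v),(v,u)$ is included (arbitrarily).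 $E^-_T$ is obtained from $E^-$: for every vertex $v$ of out-degree at least $2$ in $E^-$, with out-arcs $(v,u_1),\dots,(v,u_\ell)$ where $(v,u_\ell)$ has the largest label, for each $i<\ell$ replace $(v,u_i)$ by $(u_i,v)$ if $u_i$ has out-degree $0$ in $E^-$, and otherwise delete $(v,u_i)$. Emitters are the vertices of out-degree $0$ in $(V,E^-_T)$. Backward structure: $E^+$ is the set of arcs containing, for each vertex $v$ with $e^+(v)=\{u,v\}$, the arc $(v,u)$, except that whenever $e^+(u)=e^+(v)$ only one of $(u,v),(v,u)$ is included (arbitrarily). $E^+_T$ is obtained from $E^+$: for every vertex $v$ of in-degree at least $2$ in $E^+$, with in-arcs $(u_1,v),\dots,(u_\ell,v)$ where $(u_\ell,v)$ has the smallest label, for each $i<\ell$ replace $(u_i,v)$ by $(v,u_i)$ if $u_i$ has in-degree $0$ in $E^+$, and otherwise delete $(u_i,v)$. Collectors are the vertices of in-degree $0$ in $(V,E^+_T)$. -}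

module Defs where

open import Data.Nat using (ℕ; _<_; _≤_; _>_)
open import Data.Fin using (Fin)
open import Data.Bool using (Bool; true; not)
open import Data.Product using (_×_; ∃; ∃-syntax; Σ-syntax)
open import Data.Sum using (_⊎_)
open import Relation.Nullary using (¬_)
open import Relation.Binary.PropositionalEquality using (_≡_; _≢_)

-- Vertex set V = Fin n; the complete graph on V; the edge {u,v} (u ≢ v)
-- carries the label  lab u v  (= lab v u).  Values lab v v are irrelevant.

record SimpleTemporalClique (n : ℕ) (lab : Fin n → Fin n → ℕ) : Set where
  field
    atLeastTwo : 2 ≤ n
    symmetric  : ∀ u v → lab u v ≡ lab v u
    proper     : ∀ u v w → u ≢ v → u ≢ w → v ≢ w → lab u v ≢ lab u w

-- A tie-breaking choice for the "arbitrary" selection of one of (u,v),(v,u):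
-- for u ≢ v exactly one of  c u v, c v u  is true.
TieBreak : ∀ {n} → (Fin n → Fin n → Bool) → Set
TieBreak {n} c = ∀ (u v : Fin n) → u ≢ v → c u v ≡ not (c v u)

module _ {n : ℕ} (lab : Fin n → Fin n → ℕ) where

  MinNbr : Fin n → Fin n → Set
  MinNbr v u = u ≢ v × (∀ w → w ≢ v → w ≢ u → lab v u < lab v w)

  MaxNbr : Fin n → Fin n → Set
  MaxNbr v u = u ≢ v × (∀ w → w ≢ v → w ≢ u → lab v w < lab v u)

  module Forward (c : Fin n → Fin n → Bool) where

    -- (u,v) ∈ E⁻ : e⁻(v) = {u,v}; if also e⁻(u) = {u,v}, kept iff c u v = true
    Arc : Fin n → Fin n → Set
    Arc u v = MinNbr v u × (MinNbr u v → c u v ≡ true)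

    OutDeg0 : Fin n → Set
    OutDeg0 v = ∀ w → ¬ Arc v w

    OutDeg≥2 : Fin n → Set
    OutDeg≥2 v = ∃[ w ] ∃[ w' ] (w ≢ w' × Arc v w × Arc v w')

    MaxOut : Fin n → Fin n → Set
    MaxOut v u = Arc v u × (∀ w → Arc v w → w ≢ u → lab v w < lab v u)

    ArcT : Fin n → Fin n → Set
    ArcT a b = (Arc a b × (¬ OutDeg≥2 a ⊎ MaxOut a b))
             ⊎ (Arc b a × OutDeg≥2 b × ¬ MaxOut b a × OutDeg0 a)

    Emitter : Fin n → Set
    Emitter x = ∀ b → ¬ ArcT x b

  module Backward (c : Fin n → Fin n → Bool) where

    -- (v,u) ∈ E⁺ : e⁺(v) = {u,v}; if also e⁺(u) = {u,v}, kept iff c v u = true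
    ArcP : Fin n → Fin n → Set
    ArcP v u = MaxNbr v u × (MaxNbr u v → c v u ≡ true)

    InDeg0 : Fin n → Set
    InDeg0 v = ∀ w → ¬ ArcP w v

    InDeg≥2 : Fin n → Set
    InDeg≥2 v = ∃[ w ] ∃[ w' ] (w ≢ w' × ArcP w v × ArcP w' v)

    MinIn : Fin n → Fin n → Set
    MinIn v u = ArcP u v × (∀ w → ArcP w v → w ≢ u → lab u v < lab w v)

    ArcPT : Fin n → Fin n → Set
    ArcPT a b = (ArcP a b × (¬ InDeg≥2 b ⊎ MinIn b a))
              ⊎ (ArcP b a × InDeg≥2 a × ¬ MinIn a b × InDeg0 b)

    Collector : Fin n → Set
    Collector x = ∀ a → ¬ ArcPT a x

  JourneyToMin : Fin n → Fin n → Set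
  JourneyToMin x y =
      (x ≢ y × MinNbr y x)
    ⊎ (Σ[ w ∈ Fin n ] (x ≢ y × x ≢ w × w ≢ y × lab x w < lab w y × MinNbr y w))

  JourneyFromMax : Fin n → Fin n → Set
  JourneyFromMax z x =
      (z ≢ x × MaxNbr z x)
    ⊎ (Σ[ w ∈ Fin n ] (z ≢ x × z ≢ w × w ≢ x × MaxNbr z w × lab z w < lab w x))

  TwoHopDismountable : Fin n → Set
  TwoHopDismountable x =
    ∃[ y ] ∃[ z ] (y ≢ x × z ≢ x × JourneyToMin x y × JourneyFromMax z x)

  HasTwoHopDismountable : Set
  HasTwoHopDismountable = ∃[ x ] TwoHopDismountable x

-- Sending an emitter u to the other endpoint of e⁻(u) lands on a non-emitter, hence on a
-- collector, and is injective on emitters; dually for collectors and e⁺.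
-- The composite therefore injects the emitters into the emitters that are not collectors,
-- so by finiteness no vertex is both. In case (1) the journey x → v → u ends with e⁻(u);
-- as x is not a collector some arc of E⁺_T enters x, and every such arc yields a journey
-- of at most 2 hops into x starting with some e⁺(z). Case (2) is dual.
module Submission where

open import Defs
open import Data.Nat using (ℕ; zero; suc; _<_; _≤_; s≤s; _<?_)
open import Data.Nat.Properties using (<-cmp; <-asym; <-irrefl; ≤∧≢⇒<; n<1+n)
open import Data.Fin as Fin using (Fin; toℕ; zero; suc)
open import Data.Fin.Properties using (_≟_; all?; any?; pigeonhole)
open import Data.Bool using (Bool; true; false; not)
open import Data.Bool.Properties using () renaming (_≟_ to _≟ᵇ_)
open import Data.Product using (_×_; _,_; proj₁; proj₂; ∃; ∃₂; ∃-syntax)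
open import Data.Sum using (_⊎_; inj₁; inj₂)
open import Data.Empty using (⊥; ⊥-elim)
open import Function using (_∘_)
open import Data.List using (List; allFin; filter)
open import Data.List.Membership.Propositional using (_∈_)
open import Data.List.Extrema.Nat using (argmax; argmin; argmax-all; argmin-all; f[xs]≤f[argmax]; f[argmin]≤f[xs])
open import Data.List.Membership.Propositional.Properties using (∈-allFin; ∈-filter⁺)
open import Data.List.Relation.Unary.All using (lookup)
open import Data.List.Relation.Unary.All.Properties using (all-filter)
open import Level using (0ℓ)
open import Relation.Nullary using (¬_; Dec; yes; no)
open import Relation.Nullary.Decidable using (_×-dec_; _⊎-dec_; _→-dec_; ¬?)
open import Relation.Unary using (Pred; Decidable)
open import Relation.Binary using (tri<; tri≈; tri>)
open import Relation.Binary.PropositionalEquality using (_≡_; _≢_; refl; sym; trans; cong; subst; ≢-sym; module ≡-Reasoning)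

module StrictExtrema {n : ℕ} {P : Pred (Fin n) 0ℓ} (P? : Decidable P) (s : Fin n → ℕ)
  (s-injective : ∀ {w w'} → P w → P w' → w ≢ w' → s w ≢ s w') where

  private
    candidates : List (Fin n)
    candidates = filter P? (allFin n)

    ∈-candidates : ∀ {w} → P w → w ∈ candidates
    ∈-candidates Pw = ∈-filter⁺ P? (∈-allFin _) Pw

  strictArgmax : ∀ {w₀} → P w₀ → ∃[ b ] (P b × (∀ w → P w → w ≢ b → s w < s b))
  strictArgmax {w₀} Pw₀ = b , Pb , λ w Pw w≢b →
      ≤∧≢⇒< (lookup (f[xs]≤f[argmax] w₀ candidates) (∈-candidates Pw)) (s-injective Pw Pb w≢b)
    where
    b : Fin n
    b = argmax s w₀ candidates
    Pb : P b
    Pb = argmax-all s Pw₀ (all-filter P? (allFin n))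

  strictArgmin : ∀ {w₀} → P w₀ → ∃[ b ] (P b × (∀ w → P w → w ≢ b → s b < s w))
  strictArgmin {w₀} Pw₀ = b , Pb , λ w Pw w≢b →
      ≤∧≢⇒< (lookup (f[argmin]≤f[xs] w₀ candidates) (∈-candidates Pw)) (s-injective Pb Pw (≢-sym w≢b))
    where
    b : Fin n
    b = argmin s w₀ candidates
    Pb : P b
    Pb = argmin-all s Pw₀ (all-filter P? (allFin n))

module _ {n : ℕ} {P : Pred (Fin n) 0ℓ} (h : Fin n → Fin n)
  (h-closed : ∀ {w} → P w → P (h w))
  (h-injective : ∀ {w w'} → P w → P w' → h w ≡ h w' → w ≡ w') where

  injective-selfMap-hits : ∀ {x} → P x → ¬ (∀ {w} → P w → h w ≢ x)
  injective-selfMap-hits {x} Px missed = collision (pigeonhole (n<1+n n) (orbit ∘ toℕ))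
    where
    orbit : ℕ → Fin n
    orbit zero = x
    orbit (suc k) = h (orbit k)

    orbit-P : ∀ k → P (orbit k)
    orbit-P zero = Px
    orbit-P (suc k) = h-closed (orbit-P k)

    orbit-distinct : ∀ {i j} → i < j → orbit i ≢ orbit j
    orbit-distinct {zero} {suc j} _ x≡h = missed (orbit-P j) (sym x≡h)
    orbit-distinct {suc i} {suc j} (s≤s i<j) eq =
      orbit-distinct i<j (h-injective (orbit-P i) (orbit-P j) eq)

    collision : ∃₂ (λ i j → i Fin.< j × orbit (toℕ i) ≡ orbit (toℕ j)) → ⊥
    collision (i , j , i<j , eq) = orbit-distinct i<j eq

another-vertex : ∀ {n} → 2 ≤ n → (v : Fin n) → ∃[ w ] (w ≢ v)
another-vertex (s≤s (s≤s _)) zero = suc zero , λ ()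
another-vertex (s≤s (s≤s _)) (suc v) = zero , λ ()

tieBreak-dichotomy : ∀ {n} {c : Fin n → Fin n → Bool} → TieBreak c
  → ∀ {u v} → u ≢ v → c u v ≡ true ⊎ c v u ≡ true
tieBreak-dichotomy {c = c} tb {u} {v} u≢v with c v u in eq
... | true = inj₂ refl
... | false = inj₁ (trans (tb u v u≢v) (cong not eq))

module Decidability {n : ℕ} (lab : Fin n → Fin n → ℕ) where

  minNbr? : ∀ v u → Dec (MinNbr lab v u)
  minNbr? v u = ¬? (u ≟ v) ×-dec all? λ w →
    ¬? (w ≟ v) →-dec ¬? (w ≟ u) →-dec lab v u <? lab v w

  maxNbr? : ∀ v u → Dec (MaxNbr lab v u)
  maxNbr? v u = ¬? (u ≟ v) ×-dec all? λ w →
    ¬? (w ≟ v) →-dec ¬? (w ≟ u) →-dec lab v w <? lab v u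

  arc? : (c : Fin n → Fin n → Bool) → ∀ u v → Dec (Forward.Arc lab c u v)
  arc? c u v = minNbr? v u ×-dec (minNbr? u v →-dec c u v ≟ᵇ true)

  arcP? : (c : Fin n → Fin n → Bool) → ∀ v u → Dec (Backward.ArcP lab c v u)
  arcP? c v u = maxNbr? v u ×-dec (maxNbr? u v →-dec c v u ≟ᵇ true)

  journeyToMin? : ∀ x y → Dec (JourneyToMin lab x y)
  journeyToMin? x y = (¬? (x ≟ y) ×-dec minNbr? y x) ⊎-dec any? λ w →
    ¬? (x ≟ y) ×-dec ¬? (x ≟ w) ×-dec ¬? (w ≟ y) ×-dec (lab x w <? lab w y) ×-dec minNbr? y w

  journeyFromMax? : ∀ z x → Dec (JourneyFromMax lab z x)
  journeyFromMax? z x = (¬? (z ≟ x) ×-dec maxNbr? z x) ⊎-dec any? λ w →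
    ¬? (z ≟ x) ×-dec ¬? (z ≟ w) ×-dec ¬? (w ≟ x) ×-dec maxNbr? z w ×-dec (lab z w <? lab w x)

module Clique {n : ℕ} {lab : Fin n → Fin n → ℕ} (G : SimpleTemporalClique n lab) where

  open SimpleTemporalClique G public

  lab-injectiveʳ : ∀ {v w w'} → w ≢ v → w' ≢ v → w ≢ w' → lab v w ≢ lab v w'
  lab-injectiveʳ w≢v w'≢v = proper _ _ _ (≢-sym w≢v) (≢-sym w'≢v)

  lab-injectiveˡ : ∀ {v w w'} → w ≢ v → w' ≢ v → w ≢ w' → lab w v ≢ lab w' v
  lab-injectiveˡ {v} {w} {w'} w≢v w'≢v w≢w' eq = lab-injectiveʳ w≢v w'≢v w≢w' (begin
    lab v w  ≡⟨ symmetric v w ⟩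
    lab w v  ≡⟨ eq ⟩
    lab w' v ≡⟨ symmetric w' v ⟩
    lab v w' ∎)
    where open ≡-Reasoning

  minNbr-exists : ∀ v → ∃ (MinNbr lab v)
  minNbr-exists v = StrictExtrema.strictArgmin (λ w → ¬? (w ≟ v)) (lab v) lab-injectiveʳ
    (proj₂ (another-vertex atLeastTwo v))

  maxNbr-exists : ∀ v → ∃ (MaxNbr lab v)
  maxNbr-exists v = StrictExtrema.strictArgmax (λ w → ¬? (w ≟ v)) (lab v) lab-injectiveʳ
    (proj₂ (another-vertex atLeastTwo v))

module ForwardFacts {n : ℕ} {lab : Fin n → Fin n → ℕ} (G : SimpleTemporalClique n lab)
  {c : Fin n → Fin n → Bool} (tb : TieBreak c) where

  open Clique G
  open Decidability lab
  open Forward lab c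

  arc-tail≢head : ∀ {u v} → Arc u v → u ≢ v
  arc-tail≢head ((u≢v , _) , _) = u≢v

  maxOut-exists : ∀ {u v} → Arc u v → ∃ (MaxOut u)
  maxOut-exists {u} = StrictExtrema.strictArgmax (arc? c u) (lab u)
    (λ Aw Aw' → lab-injectiveʳ (≢-sym (arc-tail≢head Aw)) (≢-sym (arc-tail≢head Aw')))

  emitter-outDeg0 : ∀ {u} → Emitter u → OutDeg0 u
  emitter-outDeg0 em v Auv with w , Auw , greatest ← maxOut-exists Auv =
    em w (inj₁ (Auw , inj₂ (Auw , greatest)))

  emitter-minNbr-arc : ∀ {u m} → Emitter u → MinNbr lab u m → Arc m u
  emitter-minNbr-arc {u} {m} em um = um , tie
    where
    tie : MinNbr lab m u → c m u ≡ true
    tie mu with tieBreak-dichotomy tb (proj₁ um)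
    ... | inj₁ c-mu = c-mu
    ... | inj₂ c-um = ⊥-elim (emitter-outDeg0 em m (mu , λ _ → c-um))

  minNbr-of-emitter-not-emitter : ∀ {u m} → Emitter u → MinNbr lab u m → ¬ Emitter m
  minNbr-of-emitter-not-emitter em um em' = emitter-outDeg0 em' _ (emitter-minNbr-arc em um)

  -- Otherwise the arc (m,a) of E⁻ would be reversed in E⁻_T, giving a an out-arc.
  emitter-arc-maximal : ∀ {m a a'} → Emitter a → Arc m a → Arc m a' → ¬ lab m a < lab m a'
  emitter-arc-maximal {m} {a} {a'} em Ama Ama' lt =
    em m (inj₂ (Ama , (a , a' , a≢a' , Ama , Ama') , not-maxOut , emitter-outDeg0 em))
    where
    a≢a' : a ≢ a'
    a≢a' refl = <-irrefl refl lt
    not-maxOut : ¬ MaxOut m a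
    not-maxOut (_ , greatest) = <-asym lt (greatest a' Ama' (≢-sym a≢a'))

  emitter-arc-unique : ∀ {m u u'} → Emitter u → Emitter u' → Arc m u → Arc m u' → u ≡ u'
  emitter-arc-unique {m} {u} {u'} em em' Amu Amu' with u ≟ u'
  ... | yes u≡u' = u≡u'
  ... | no u≢u' with <-cmp (lab m u) (lab m u')
  ...   | tri< lt _ _ = ⊥-elim (emitter-arc-maximal em Amu Amu' lt)
  ...   | tri≈ _ eq _ = ⊥-elim (lab-injectiveʳ (≢-sym (arc-tail≢head Amu)) (≢-sym (arc-tail≢head Amu')) u≢u' eq)
  ...   | tri> _ _ gt = ⊥-elim (emitter-arc-maximal em' Amu' Amu gt)

  minNbr-injective-on-emitters : ∀ {u u' m} → Emitter u → Emitter u'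
    → MinNbr lab u m → MinNbr lab u' m → u ≡ u'
  minNbr-injective-on-emitters em em' um u'm =
    emitter-arc-unique em em' (emitter-minNbr-arc em um) (emitter-minNbr-arc em' u'm)

  arcT⇒journeyToMin : ∀ {x b} → ArcT x b → ∃[ y ] (y ≢ x × JourneyToMin lab x y)
  arcT⇒journeyToMin (inj₁ (Axb , _)) =
    _ , ≢-sym (arc-tail≢head Axb) , inj₁ (arc-tail≢head Axb , proj₁ Axb)
  arcT⇒journeyToMin {x} {b} (inj₂ (Abx , _ , not-maxOut , _))
    with y , Aby , greatest ← maxOut-exists Abx | y ≟ x
  ... | yes refl = ⊥-elim (not-maxOut (Aby , greatest))
  ... | no y≢x = y , y≢x , inj₂ (b , ≢-sym y≢x , ≢-sym (arc-tail≢head Abx) , arc-tail≢head Aby ,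
                                 subst (_< lab b y) (symmetric b x) (greatest x Abx (≢-sym y≢x)) ,
                                 proj₁ Aby)

  emitter-or-journeyToMin : ∀ x → Emitter x ⊎ ∃[ y ] (y ≢ x × JourneyToMin lab x y)
  emitter-or-journeyToMin x with any? (λ y → ¬? (y ≟ x) ×-dec journeyToMin? x y)
  ... | yes journey = inj₂ journey
  ... | no no-journey = inj₁ (λ b ArcT-xb → no-journey (arcT⇒journeyToMin ArcT-xb))

module BackwardFacts {n : ℕ} {lab : Fin n → Fin n → ℕ} (G : SimpleTemporalClique n lab)
  {c : Fin n → Fin n → Bool} (tb : TieBreak c) where

  open Clique G
  open Decidability lab
  open Backward lab c

  arcP-tail≢head : ∀ {v u} → ArcP v u → v ≢ u
  arcP-tail≢head ((u≢v , _) , _) = ≢-sym u≢v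

  minIn-exists : ∀ {w v} → ArcP w v → ∃ (MinIn v)
  minIn-exists {v = v} = StrictExtrema.strictArgmin (λ w → arcP? c w v) (λ w → lab w v)
    (λ Aw Aw' → lab-injectiveˡ (arcP-tail≢head Aw) (arcP-tail≢head Aw'))

  collector-inDeg0 : ∀ {v} → Collector v → InDeg0 v
  collector-inDeg0 co w Awv with u , Auv , least ← minIn-exists Awv =
    co u (inj₁ (Auv , inj₂ (Auv , least)))

  collector-maxNbr-arc : ∀ {v a} → Collector v → MaxNbr lab v a → ArcP v a
  collector-maxNbr-arc {v} {a} co va = va , tie
    where
    tie : MaxNbr lab a v → c v a ≡ true
    tie av with tieBreak-dichotomy tb (≢-sym (proj₁ va))
    ... | inj₁ c-va = c-va
    ... | inj₂ c-av = ⊥-elim (collector-inDeg0 co a (av , λ _ → c-av))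

  maxNbr-of-collector-not-collector : ∀ {v a} → Collector v → MaxNbr lab v a → ¬ Collector a
  maxNbr-of-collector-not-collector co va co' = collector-inDeg0 co' _ (collector-maxNbr-arc co va)

  -- Otherwise the arc (v',a) of E⁺ would be reversed in E⁺_T, giving v' an in-arc.
  collector-arc-minimal : ∀ {a v v'} → Collector v' → ArcP v a → ArcP v' a → ¬ lab v a < lab v' a
  collector-arc-minimal {a} {v} {v'} co' Ava Av'a lt =
    co' a (inj₂ (Av'a , (v , v' , v≢v' , Ava , Av'a) , not-minIn , collector-inDeg0 co'))
    where
    v≢v' : v ≢ v'
    v≢v' refl = <-irrefl refl lt
    not-minIn : ¬ MinIn a v'
    not-minIn (_ , least) = <-asym lt (least v Ava v≢v')

  collector-arc-unique : ∀ {a v v'} → Collector v → Collector v' → ArcP v a → ArcP v' a → v ≡ v'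
  collector-arc-unique {a} {v} {v'} co co' Ava Av'a with v ≟ v'
  ... | yes v≡v' = v≡v'
  ... | no v≢v' with <-cmp (lab v a) (lab v' a)
  ...   | tri< lt _ _ = ⊥-elim (collector-arc-minimal co' Ava Av'a lt)
  ...   | tri≈ _ eq _ = ⊥-elim (lab-injectiveˡ (arcP-tail≢head Ava) (arcP-tail≢head Av'a) v≢v' eq)
  ...   | tri> _ _ gt = ⊥-elim (collector-arc-minimal co Av'a Ava gt)

  maxNbr-injective-on-collectors : ∀ {v v' a} → Collector v → Collector v'
    → MaxNbr lab v a → MaxNbr lab v' a → v ≡ v'
  maxNbr-injective-on-collectors co co' va v'a =
    collector-arc-unique co co' (collector-maxNbr-arc co va) (collector-maxNbr-arc co' v'a)

  arcPT⇒journeyFromMax : ∀ {a x} → ArcPT a x → ∃[ z ] (z ≢ x × JourneyFromMax lab z x)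
  arcPT⇒journeyFromMax (inj₁ (Aax , _)) =
    _ , arcP-tail≢head Aax , inj₁ (arcP-tail≢head Aax , proj₁ Aax)
  arcPT⇒journeyFromMax {a} {x} (inj₂ (Axa , _ , not-minIn , _))
    with z , Aza , least ← minIn-exists Axa | z ≟ x
  ... | yes refl = ⊥-elim (not-minIn (Aza , least))
  ... | no z≢x = z , z≢x , inj₂ (a , z≢x , arcP-tail≢head Aza , ≢-sym (arcP-tail≢head Axa) ,
                                 proj₁ Aza ,
                                 subst (lab z a <_) (symmetric x a) (least x Axa (≢-sym z≢x)))

  collector-or-journeyFromMax : ∀ x → Collector x ⊎ ∃[ z ] (z ≢ x × JourneyFromMax lab z x)
  collector-or-journeyFromMax x with any? (λ z → ¬? (z ≟ x) ×-dec journeyFromMax? z x)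
  ... | yes journey = inj₂ journey
  ... | no no-journey = inj₁ (λ a ArcPT-ax → no-journey (arcPT⇒journeyFromMax ArcPT-ax))

module Covered {n : ℕ} {lab : Fin n → Fin n → ℕ} (G : SimpleTemporalClique n lab)
  {c⁻ c⁺ : Fin n → Fin n → Bool} (tb⁻ : TieBreak c⁻) (tb⁺ : TieBreak c⁺)
  (cover : ∀ v → Forward.Emitter lab c⁻ v ⊎ Backward.Collector lab c⁺ v) where

  open Clique G
  open Forward lab c⁻
  open Backward lab c⁺
  open ForwardFacts G tb⁻
  open BackwardFacts G tb⁺

  nbr⁻ nbr⁺ : Fin n → Fin n
  nbr⁻ v = proj₁ (minNbr-exists v)
  nbr⁺ v = proj₁ (maxNbr-exists v)

  nbr⁻-collector : ∀ {w} → Emitter w → Collector (nbr⁻ w)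
  nbr⁻-collector {w} em with cover (nbr⁻ w)
  ... | inj₁ em' = ⊥-elim (minNbr-of-emitter-not-emitter em (proj₂ (minNbr-exists w)) em')
  ... | inj₂ co = co

  nbr⁺-emitter : ∀ {w} → Collector w → Emitter (nbr⁺ w)
  nbr⁺-emitter {w} co with cover (nbr⁺ w)
  ... | inj₁ em = em
  ... | inj₂ co' = ⊥-elim (maxNbr-of-collector-not-collector co (proj₂ (maxNbr-exists w)) co')

  nbr⁻-injective-on-emitters : ∀ {w w'} → Emitter w → Emitter w' → nbr⁻ w ≡ nbr⁻ w' → w ≡ w'
  nbr⁻-injective-on-emitters {w} {w'} em em' eq = minNbr-injective-on-emitters em em'
    (proj₂ (minNbr-exists w)) (subst (MinNbr lab w') (sym eq) (proj₂ (minNbr-exists w')))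

  nbr⁺-injective-on-collectors : ∀ {w w'} → Collector w → Collector w' → nbr⁺ w ≡ nbr⁺ w' → w ≡ w'
  nbr⁺-injective-on-collectors {w} {w'} co co' eq = maxNbr-injective-on-collectors co co'
    (proj₂ (maxNbr-exists w)) (subst (MaxNbr lab w') (sym eq) (proj₂ (maxNbr-exists w')))

  emitter-not-collector : ∀ {x} → Emitter x → ¬ Collector x
  emitter-not-collector {x} em co = injective-selfMap-hits (nbr⁺ ∘ nbr⁻)
    (λ em → nbr⁺-emitter (nbr⁻-collector em))
    (λ em em' → nbr⁻-injective-on-emitters em em'
               ∘ nbr⁺-injective-on-collectors (nbr⁻-collector em) (nbr⁻-collector em'))
    em missed
    where
    missed : ∀ {w} → Emitter w → nbr⁺ (nbr⁻ w) ≢ x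
    missed {w} em' eq = maxNbr-of-collector-not-collector (nbr⁻-collector em')
      (proj₂ (maxNbr-exists (nbr⁻ w))) (subst Collector (sym eq) co)

  dismountable-via-emitters : (∃[ u ] ∃[ v ] (Emitter u × MinNbr lab u v
      × ∃[ x ] (Emitter x × x ≢ v × lab v x < lab v u)))
    → HasTwoHopDismountable lab
  dismountable-via-emitters (u , v , _ , uv , x , em , x≢v , lt) with collector-or-journeyFromMax x
  ... | inj₁ co = ⊥-elim (emitter-not-collector em co)
  ... | inj₂ (z , z≢x , z⇝x) = x , u , z , ≢-sym x≢u , z≢x , x⇝u , z⇝x
    where
    x≢u : x ≢ u
    x≢u refl = <-irrefl refl lt
    x⇝u : JourneyToMin lab x u
    x⇝u = inj₂ (v , x≢u , x≢v , proj₁ uv , subst (_< lab v u) (symmetric v x) lt , uv)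

  dismountable-via-collectors : (∃[ v ] ∃[ u ] (Collector v × MaxNbr lab v u
      × ∃[ y ] (Collector y × y ≢ u × lab u v < lab u y)))
    → HasTwoHopDismountable lab
  dismountable-via-collectors (v , u , _ , vu , y , co , y≢u , lt) with emitter-or-journeyToMin y
  ... | inj₁ em = ⊥-elim (emitter-not-collector em co)
  ... | inj₂ (x , x≢y , y⇝x) = y , x , v , x≢y , v≢y , y⇝x , v⇝y
    where
    v≢y : v ≢ y
    v≢y refl = <-irrefl refl lt
    v⇝y : JourneyFromMax lab v y
    v⇝y = inj₂ (u , v≢y , ≢-sym (proj₁ vu) , ≢-sym y≢u , vu , subst (_< lab u y) (symmetric u v) lt)

lemma7 : (n : ℕ) (lab : Fin n → Fin n → ℕ) → SimpleTemporalClique n lab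
    → (c⁻ c⁺ : Fin n → Fin n → Bool) → TieBreak c⁻ → TieBreak c⁺
    → (∀ v → Forward.Emitter lab c⁻ v ⊎ Backward.Collector lab c⁺ v)
    → ((∃[ u ] ∃[ v ] (Forward.Emitter lab c⁻ u × MinNbr lab u v
          × ∃[ x ] (Forward.Emitter lab c⁻ x × x ≢ v × lab v x < lab v u)))
        → HasTwoHopDismountable lab)
      × ((∃[ v ] ∃[ u ] (Backward.Collector lab c⁺ v × MaxNbr lab v u
          × ∃[ y ] (Backward.Collector lab c⁺ y × y ≢ u × lab u v < lab u y)))
        → HasTwoHopDismountable lab)
lemma7 n lab G c⁻ c⁺ tb⁻ tb⁺ cover = dismountable-via-emitters , dismountable-via-collectors
  where open Covered G tb⁻ tb⁺ cover
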